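{- For every integer $n\ge 2$, the number of $2_0$-Dyck paths of length $3n$ having exactly two down-steps at a height of $1$ modulo $2$ and $n-2$ down-steps at a height of $2$ modulo $2$ equals the sum, over all Dyck paths of length $2n-2$, of the indices of the down-steps of all valleys of the path.
   Context: For non-negative integers $k,t,n$ with $0\le t<k$, a $k_t$-Dyck path of length $(k+1)n$ is a lattice path consisting of $n$ down-steps $(1,-k)$ and $kn$ up-steps $(1,1)$ that starts at $(0,0)$, ends at $((k+1)n,0)$, and stays weakly above the line $y=-t$. A down-step is at a height of $i$ modulo $k$ if its endpoint's $y$-coordinate is congruent to $i$ modulo $k$. A Dyck path of length $2m$ is a path of $m$ steps $(1,1)$ and $m$ steps $(1,-1)$ from $(0,0)$ to $(2m,0)$ staying weakly above the $x$-axis. A valley is a down-step immediately followed by an up-step; the index of a step is its position in the path, counting steps from $1$ at the left. -}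

module Defs where

open import Data.Nat as ℕ using (ℕ; zero; suc; _+_; _*_; _∸_; NonZero)
open import Data.Nat.Properties as ℕP using ()
open import Data.Integer as ℤ using (ℤ; +_; -_)
open import Data.Integer.Properties as ℤP using ()
open import Data.Integer.DivMod using (_%ℕ_)
open import Data.List using (List; []; _∷_; length; filter; map; concatMap)
open import Data.Nat.ListAction using (sum)
open import Data.List.Relation.Unary.All using (All; all?)
open import Data.Product using (_×_; _,_)
open import Relation.Nullary using (Dec; yes; no)
open import Relation.Nullary.Decidable using (_×-dec_)
open import Relation.Binary.PropositionalEquality using (_≡_)

-- Steps of a lattice path: up-step (1,1) or down-step (1,-k).
data Step : Set where
  U D : Step

allWords : ℕ → List (List Step)
allWords zero    = [] ∷ []
allWords (suc m) = concatMap (λ w → (U ∷ w) ∷ (D ∷ w) ∷ []) (allWords m)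

countU countD : List Step → ℕ
countU []      = 0
countU (U ∷ p) = suc (countU p)
countU (D ∷ p) = countU p
countD []      = 0
countD (U ∷ p) = countD p
countD (D ∷ p) = suc (countD p)

stepK : ℕ → ℤ → Step → ℤ
stepK k y U = y ℤ.+ + 1
stepK k y D = y ℤ.- + k

heightsK : ℕ → ℤ → List Step → List ℤ
heightsK k y []      = []
heightsK k y (s ∷ p) = stepK k y s ∷ heightsK k (stepK k y s) p

finalK : ℕ → ℤ → List Step → ℤ
finalK k y []      = y
finalK k y (s ∷ p) = finalK k (stepK k y s) p

-- p is a k_t-Dyck path of length (k+1)n: n down-steps (1,-k), kn up-steps,
-- from (0,0) to ((k+1)n,0), weakly above the line y = -t.
IsKtDyck : (k t n : ℕ) → List Step → Set
IsKtDyck k t n p =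
  length p ≡ (k + 1) * n × countD p ≡ n × countU p ≡ k * n ×
  finalK k (+ 0) p ≡ + 0 × All (λ y → - (+ t) ℤ.≤ y) (heightsK k (+ 0) p)

isKtDyck? : (k t n : ℕ) → (p : List Step) → Dec (IsKtDyck k t n p)
isKtDyck? k t n p =
  (length p ℕ.≟ (k + 1) * n) ×-dec (countD p ℕ.≟ n) ×-dec (countU p ℕ.≟ k * n) ×-dec
  (finalK k (+ 0) p ℤ.≟ + 0) ×-dec all? (λ y → - (+ t) ℤ.≤? y) (heightsK k (+ 0) p)

downsAtHeightMod : (k : ℕ) .{{_ : NonZero k}} → ℕ → ℤ → List Step → ℕ
downsAtHeightMod k i y []      = 0
downsAtHeightMod k i y (U ∷ p) = downsAtHeightMod k i (stepK k y U) p
downsAtHeightMod k i y (D ∷ p) with (stepK k y D %ℕ k) ℕ.≟ (i ℕ.% k)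
... | yes _ = suc (downsAtHeightMod k i (stepK k y D) p)
... | no  _ = downsAtHeightMod k i (stepK k y D) p

IsDyck : ℕ → List Step → Set
IsDyck m p =
  length p ≡ 2 * m × countU p ≡ m × countD p ≡ m ×
  finalK 1 (+ 0) p ≡ + 0 × All (λ y → + 0 ℤ.≤ y) (heightsK 1 (+ 0) p)

isDyck? : (m : ℕ) → (p : List Step) → Dec (IsDyck m p)
isDyck? m p =
  (length p ℕ.≟ 2 * m) ×-dec (countU p ℕ.≟ m) ×-dec (countD p ℕ.≟ m) ×-dec
  (finalK 1 (+ 0) p ℤ.≟ + 0) ×-dec all? (λ y → + 0 ℤ.≤? y) (heightsK 1 (+ 0) p)

-- Sum of the indices (1-based positions) of the down-steps of all valleys
-- (a down-step immediately followed by an up-step); the first step has index i.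
valleyIndexSumFrom : ℕ → List Step → ℕ
valleyIndexSumFrom i []            = 0
valleyIndexSumFrom i (D ∷ U ∷ p)   = i + valleyIndexSumFrom (suc i) (U ∷ p)
valleyIndexSumFrom i (D ∷ D ∷ p)   = valleyIndexSumFrom (suc i) (D ∷ p)
valleyIndexSumFrom i (D ∷ [])      = 0
valleyIndexSumFrom i (U ∷ p)       = valleyIndexSumFrom (suc i) p

valleyIndexSum : List Step → ℕ
valleyIndexSum = valleyIndexSumFrom 1

countTwoZeroDyck : ℕ → ℕ
countTwoZeroDyck n =
  length (filter (λ p → isKtDyck? 2 0 n p ×-dec
                         (downsAtHeightMod 2 1 (+ 0) p ℕ.≟ 2) ×-dec
                         (downsAtHeightMod 2 2 (+ 0) p ℕ.≟ n ∸ 2))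
                 (allWords (3 * n)))

dyckValleyIndexTotal : ℕ → ℕ
dyckValleyIndexTotal m = sum (map valleyIndexSum (filter (isDyck? m) (allWords (2 * m))))

-- Cut a 2_0-Dyck path, started at an even height, into the blocks D and U D^j U
-- (j ≥ 0); its down-steps landing at an odd height are exactly the inner D's of
-- the blocks.  Reading the blocks D, UU, UDU, UDDU as D, U, DU, DUD turns the
-- paths of length 3n with two such down-steps into the Dyck paths of length 2n
-- carrying either two marked valleys or one marked factor DUD.  Both families are
-- counted by the same recurrences on length and height, and the marked Dyck paths
-- of length 2n obey the recurrence of the valley-index sums over the Dyck paths of
-- length 2n - 2, because prepending a step shifts every valley index by one.
module Submission where

open import Defs
open import Function using (_∘_)
open import Data.Nat using (ℕ; zero; suc; pred; _+_; _*_; _∸_; _≤_; _<_; s≤s; z≤n; _%_; _≟_)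
open import Data.Nat.Properties
open import Data.Nat.Tactic.RingSolver using (solve-∀)
open import Data.Integer as ℤ using (ℤ; +_; +≤+)
import Data.Integer.Properties as ℤ
import Data.Integer.Tactic.RingSolver as ℤ-Solver
open import Data.Integer.DivMod using (n%ℕd<d)
open import Data.List using (List; []; _∷_; length; filter; map; concatMap)
open import Data.Nat.ListAction using (sum)
open import Data.List.Relation.Unary.All using (All; []; _∷_)
import Data.List.Relation.Unary.All as All
open import Data.Bool using (true; false; if_then_else_)
open import Data.Product using (_×_; _,_)
open import Data.Sum using (_⊎_; inj₁; inj₂; [_,_])
open import Data.Empty using (⊥-elim)
open import Relation.Nullary using (Dec; yes; no; does; contradiction)
open import Relation.Nullary.Decidable using (_×-dec_)
open import Relation.Binary.PropositionalEquality hiding ([_])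
open ≡-Reasoning

private
  variable
    A : Set

sum-map-+ : ∀ (f g : A → ℕ) xs → sum (map (λ x → f x + g x) xs) ≡ sum (map f xs) + sum (map g xs)
sum-map-+ f g []       = refl
sum-map-+ f g (x ∷ xs) = begin
  f x + g x + sum (map (λ x → f x + g x) xs)      ≡⟨ cong (λ s → f x + g x + s) (sum-map-+ f g xs) ⟩
  f x + g x + (sum (map f xs) + sum (map g xs))  ≡⟨ +-regroup (f x) (g x) _ _ ⟩
  f x + sum (map f xs) + (g x + sum (map g xs))  ∎
  where
  +-regroup : ∀ a b c d → a + b + (c + d) ≡ a + c + (b + d)
  +-regroup = solve-∀

sum-map-*ʳ : ∀ (f : A → ℕ) c xs → sum (map (λ x → f x * c) xs) ≡ sum (map f xs) * c
sum-map-*ʳ f c []       = refl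
sum-map-*ʳ f c (x ∷ xs) = trans (cong (λ s → f x * c + s) (sum-map-*ʳ f c xs)) (sym (*-distribʳ-+ c (f x) _))

sum-map-cong-All : ∀ {f g : A → ℕ} {xs} → All (λ x → f x ≡ g x) xs → sum (map f xs) ≡ sum (map g xs)
sum-map-cong-All []       = refl
sum-map-cong-All (e ∷ es) = cong₂ _+_ e (sum-map-cong-All es)

indicator : {P : A → Set} → ((x : A) → Dec (P x)) → A → ℕ
indicator P? x = if does (P? x) then 1 else 0

length-filter≡sum-indicator : ∀ {P : A → Set} (P? : (x : A) → Dec (P x)) xs →
  length (filter P? xs) ≡ sum (map (indicator P?) xs)
length-filter≡sum-indicator P? []       = refl
length-filter≡sum-indicator P? (x ∷ xs) with does (P? x)
... | true  = cong suc (length-filter≡sum-indicator P? xs)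
... | false = length-filter≡sum-indicator P? xs

sum-map-filter : ∀ {P : A → Set} (P? : (x : A) → Dec (P x)) (f : A → ℕ) xs →
  sum (map f (filter P? xs)) ≡ sum (map (λ x → indicator P? x * f x) xs)
sum-map-filter P? f []       = refl
sum-map-filter P? f (x ∷ xs) with does (P? x)
... | true  = cong₂ _+_ (sym (+-identityʳ (f x))) (sum-map-filter P? f xs)
... | false = sum-map-filter P? f xs

indicator-≡ : ∀ {P : A → Set} (P? : (x : A) → Dec (P x)) {x n} →
  n ≡ 0 ⊎ n ≡ 1 → (P x → n ≡ 1) → (n ≡ 1 → P x) → indicator P? x ≡ n
indicator-≡ P? {x} n∈01 to from with P? x | n∈01
... | yes px  | _        = sym (to px)
... | no  _   | inj₁ n≡0 = sym n≡0
... | no  ¬px | inj₂ n≡1 = contradiction (from n≡1) ¬px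

sumWords : ℕ → (List Step → ℕ) → ℕ
sumWords L f = sum (map f (allWords L))

sumWords-suc : ∀ L f → sumWords (suc L) f ≡ sumWords L (f ∘ (U ∷_)) + sumWords L (f ∘ (D ∷_))
sumWords-suc L f = trans (sum-concat (allWords L)) (sum-map-+ (f ∘ (U ∷_)) (f ∘ (D ∷_)) (allWords L))
  where
  sum-concat : ∀ ws → sum (map f (concatMap (λ w → (U ∷ w) ∷ (D ∷ w) ∷ []) ws)) ≡
                      sum (map (λ w → f (U ∷ w) + f (D ∷ w)) ws)
  sum-concat []       = refl
  sum-concat (w ∷ ws) = trans (cong (λ s → f (U ∷ w) + (f (D ∷ w) + s)) (sum-concat ws))
                              (sym (+-assoc (f (U ∷ w)) (f (D ∷ w)) _))

length-allWords : ∀ L → All (λ w → length w ≡ L) (allWords L)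
length-allWords zero    = refl ∷ []
length-allWords (suc L) = extend (length-allWords L)
  where
  extend : ∀ {ws} → All (λ w → length w ≡ L) ws →
           All (λ w → length w ≡ suc L) (concatMap (λ w → (U ∷ w) ∷ (D ∷ w) ∷ []) ws)
  extend []       = []
  extend (e ∷ es) = cong suc e ∷ cong suc e ∷ extend es

sumWords-cong : ∀ L {f g} → (∀ w → length w ≡ L → f w ≡ g w) → sumWords L f ≡ sumWords L g
sumWords-cong L f≗g = sum-map-cong-All (All.map (f≗g _) (length-allWords L))

sumWords-suc-U : ∀ L f → (∀ w → f (D ∷ w) ≡ 0) → sumWords (suc L) f ≡ sumWords L (f ∘ (U ∷_))
sumWords-suc-U L f noD = begin
  sumWords (suc L) f                                     ≡⟨ sumWords-suc L f ⟩
  sumWords L (f ∘ (U ∷_)) + sumWords L (f ∘ (D ∷_))     ≡⟨ cong (λ s → sumWords L (f ∘ (U ∷_)) + s) no-D-words ⟩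
  sumWords L (f ∘ (U ∷_)) + 0                           ≡⟨ +-identityʳ _ ⟩
  sumWords L (f ∘ (U ∷_))                               ∎
  where
  no-D-words : sumWords L (f ∘ (D ∷_)) ≡ 0
  no-D-words = trans (sumWords-cong L λ w _ → noD w) (sum-zeros (allWords L))
    where
    sum-zeros : ∀ (ws : List (List Step)) → sum (map (λ _ → 0) ws) ≡ 0
    sum-zeros []       = refl
    sum-zeros (_ ∷ ws) = sum-zeros ws

length≡countU+countD : ∀ p → length p ≡ countU p + countD p
length≡countU+countD []      = refl
length≡countU+countD (U ∷ p) = cong suc (length≡countU+countD p)
length≡countU+countD (D ∷ p) = trans (cong suc (length≡countU+countD p)) (sym (+-suc (countU p) (countD p)))

finalK-+-k*countD : ∀ k y p → finalK k y p ℤ.+ + (k * countD p) ≡ y ℤ.+ + countU p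
finalK-+-k*countD k y []      = cong (λ n → y ℤ.+ + n) (*-zeroʳ k)
finalK-+-k*countD k y (U ∷ p) = trans (finalK-+-k*countD k (y ℤ.+ + 1) p) (ℤ.+-assoc y (+ 1) (+ countU p))
finalK-+-k*countD k y (D ∷ p) = begin
  finalK k y′ p ℤ.+ + (k * suc (countD p))      ≡⟨ cong (λ n → finalK k y′ p ℤ.+ + n) (*-suc k (countD p)) ⟩
  finalK k y′ p ℤ.+ (+ k ℤ.+ + (k * countD p)) ≡⟨ move-k (finalK k y′ p) (+ k) _ ⟩
  finalK k y′ p ℤ.+ + (k * countD p) ℤ.+ + k   ≡⟨ cong (ℤ._+ + k) (finalK-+-k*countD k y′ p) ⟩
  y′ ℤ.+ + countU p ℤ.+ + k                     ≡⟨ cancel-k y (+ k) (+ countU p) ⟩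
  y ℤ.+ + countU p                              ∎
  where
  y′ : ℤ
  y′ = y ℤ.- + k
  move-k : ∀ f k c → f ℤ.+ (k ℤ.+ c) ≡ f ℤ.+ c ℤ.+ k
  move-k = ℤ-Solver.solve-∀
  cancel-k : ∀ y k u → y ℤ.- k ℤ.+ u ℤ.+ k ≡ y ℤ.+ u
  cancel-k = ℤ-Solver.solve-∀

countU≡k*countD : ∀ k p → finalK k (+ 0) p ≡ + 0 → countU p ≡ k * countD p
countU≡k*countD k p ends-at-0 = sym (ℤ.+-injective (begin
  + (k * countD p)                              ≡⟨ cong (ℤ._+ + (k * countD p)) (sym ends-at-0) ⟩
  finalK k (+ 0) p ℤ.+ + (k * countD p)         ≡⟨ finalK-+-k*countD k (+ 0) p ⟩
  + countU p                                    ∎))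

countD≡ : ∀ k {n} p → finalK k (+ 0) p ≡ + 0 → length p ≡ (k + 1) * n → countD p ≡ n
countD≡ k {n} p ends-at-0 len = *-cancelˡ-≡ (countD p) n (suc k) (begin
  suc k * countD p            ≡⟨ +-comm (countD p) (k * countD p) ⟩
  k * countD p + countD p     ≡⟨ cong (_+ countD p) (sym (countU≡k*countD k p ends-at-0)) ⟩
  countU p + countD p         ≡⟨ sym (length≡countU+countD p) ⟩
  length p                    ≡⟨ len ⟩
  (k + 1) * n                 ≡⟨ cong (_* n) (+-comm k 1) ⟩
  suc k * n                   ∎)

Excursion : ℕ → ℤ → List Step → Set
Excursion k y p = finalK k y p ≡ + 0 × All (+ 0 ℤ.≤_) (heightsK k y p)

excursion-U : ∀ {k h p} → Excursion k (+ suc h) p → Excursion k (+ h) (U ∷ p)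
excursion-U {h = h} (ends-at-0 , nonneg) rewrite +-comm h 1 = ends-at-0 , +≤+ z≤n ∷ nonneg

excursion-U⁻ : ∀ {k h p} → Excursion k (+ h) (U ∷ p) → Excursion k (+ suc h) p
excursion-U⁻ {h = h} (ends-at-0 , _ ∷ nonneg) rewrite +-comm h 1 = ends-at-0 , nonneg

atZero : ℕ → ℕ
atZero zero    = 1
atZero (suc _) = 0

dyckFrom : ℕ → List Step → ℕ
dyckFrom h       []      = atZero h
dyckFrom h       (U ∷ p) = dyckFrom (suc h) p
dyckFrom zero    (D ∷ p) = 0
dyckFrom (suc h) (D ∷ p) = dyckFrom h p

dyckFrom-0or1 : ∀ h p → dyckFrom h p ≡ 0 ⊎ dyckFrom h p ≡ 1
dyckFrom-0or1 zero    []      = inj₂ refl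
dyckFrom-0or1 (suc h) []      = inj₁ refl
dyckFrom-0or1 h       (U ∷ p) = dyckFrom-0or1 (suc h) p
dyckFrom-0or1 zero    (D ∷ p) = inj₁ refl
dyckFrom-0or1 (suc h) (D ∷ p) = dyckFrom-0or1 h p

dyckFrom-sound : ∀ h p → dyckFrom h p ≡ 1 → Excursion 1 (+ h) p
dyckFrom-sound zero    []      _ = refl , []
dyckFrom-sound h       (U ∷ p) e = excursion-U (dyckFrom-sound (suc h) p e)
dyckFrom-sound (suc h) (D ∷ p) e with dyckFrom-sound h p e
... | ends-at-0 , nonneg = ends-at-0 , +≤+ z≤n ∷ nonneg

dyckFrom-complete : ∀ h p → Excursion 1 (+ h) p → dyckFrom h p ≡ 1
dyckFrom-complete zero    []      _                        = refl
dyckFrom-complete h       (U ∷ p) ex                       = dyckFrom-complete (suc h) p (excursion-U⁻ ex)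
dyckFrom-complete zero    (D ∷ p) (_ , () ∷ _)
dyckFrom-complete (suc h) (D ∷ p) (ends-at-0 , _ ∷ nonneg) = dyckFrom-complete h p (ends-at-0 , nonneg)

isDyck-fromExcursion : ∀ m p → length p ≡ 2 * m → Excursion 1 (+ 0) p → IsDyck m p
isDyck-fromExcursion m p len (ends-at-0 , nonneg) = len , ups≡m , downs≡m , ends-at-0 , nonneg
  where
  downs≡m : countD p ≡ m
  downs≡m = countD≡ 1 p ends-at-0 len
  ups≡m : countU p ≡ m
  ups≡m = trans (countU≡k*countD 1 p ends-at-0) (trans (*-identityˡ (countD p)) downs≡m)

indicator-isDyck : ∀ m p → length p ≡ 2 * m → indicator (isDyck? m) p ≡ dyckFrom 0 p
indicator-isDyck m p len = indicator-≡ (isDyck? m) (dyckFrom-0or1 0 p)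
  (λ (_ , _ , _ , ex) → dyckFrom-complete 0 p ex)
  (isDyck-fromExcursion m p len ∘ dyckFrom-sound 0 p)

twice : ℕ → ℕ
twice zero    = zero
twice (suc a) = suc (suc (twice a))

twice%2 : ∀ a → twice a % 2 ≡ 0
twice%2 zero    = refl
twice%2 (suc a) = twice%2 a

suc-twice%2 : ∀ a → suc (twice a) % 2 ≡ 1
suc-twice%2 zero    = refl
suc-twice%2 (suc a) = suc-twice%2 a

downsAtOdd-D-even : ∀ a p → downsAtHeightMod 2 1 (+ twice (suc a)) (D ∷ p) ≡ downsAtHeightMod 2 1 (+ twice a) p
downsAtOdd-D-even a p with twice a % 2 ≟ 1
... | yes odd = contradiction (trans (sym (twice%2 a)) odd) λ ()
... | no  _   = refl

downsAtOdd-D-odd : ∀ a p →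
  downsAtHeightMod 2 1 (+ suc (twice (suc a))) (D ∷ p) ≡ suc (downsAtHeightMod 2 1 (+ suc (twice a)) p)
downsAtOdd-D-odd a p with suc (twice a) % 2 ≟ 1
... | yes _    = refl
... | no  even = contradiction (suc-twice%2 a) even

downsAtOdd+downsAtEven≡countD : ∀ y p → downsAtHeightMod 2 1 y p + downsAtHeightMod 2 2 y p ≡ countD p
downsAtOdd+downsAtEven≡countD y []      = refl
downsAtOdd+downsAtEven≡countD y (U ∷ p) = downsAtOdd+downsAtEven≡countD (stepK 2 y U) p
downsAtOdd+downsAtEven≡countD y (D ∷ p)
  with stepK 2 y D ℤ.%ℕ 2 ≟ 1 | stepK 2 y D ℤ.%ℕ 2 ≟ 0
... | yes odd  | yes even = contradiction (trans (sym odd) even) λ ()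
... | yes _    | no  _    = cong suc (downsAtOdd+downsAtEven≡countD (stepK 2 y D) p)
... | no  _    | yes _    = trans (+-suc _ _) (cong suc (downsAtOdd+downsAtEven≡countD (stepK 2 y D) p))
... | no  ¬odd | no  ¬even =
  ⊥-elim ([ ¬even , ¬odd ] (n≤1⇒n≡0∨n≡1 (≤-pred (n%ℕd<d (stepK 2 y D) 2))))

TwoDyckFrom : ℤ → ℕ → List Step → Set
TwoDyckFrom y r p = Excursion 2 y p × downsAtHeightMod 2 1 y p ≡ r

twoDyck-U : ∀ {h r p} → TwoDyckFrom (+ suc h) r p → TwoDyckFrom (+ h) r (U ∷ p)
twoDyck-U {h} ((ends-at-0 , nonneg) , marks) rewrite +-comm h 1 = (ends-at-0 , +≤+ z≤n ∷ nonneg) , marks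

twoDyck-U⁻ : ∀ {h r p} → TwoDyckFrom (+ h) r (U ∷ p) → TwoDyckFrom (+ suc h) r p
twoDyck-U⁻ {h} ((ends-at-0 , _ ∷ nonneg) , marks) rewrite +-comm h 1 = (ends-at-0 , nonneg) , marks

twoDyck-D-even : ∀ {a r p} → TwoDyckFrom (+ twice a) r p → TwoDyckFrom (+ twice (suc a)) r (D ∷ p)
twoDyck-D-even {a} {p = p} ((ends-at-0 , nonneg) , marks) =
  (ends-at-0 , +≤+ z≤n ∷ nonneg) , trans (downsAtOdd-D-even a p) marks

twoDyck-D-even⁻ : ∀ {a r p} → TwoDyckFrom (+ twice (suc a)) r (D ∷ p) → TwoDyckFrom (+ twice a) r p
twoDyck-D-even⁻ {a} {p = p} ((ends-at-0 , _ ∷ nonneg) , marks) =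
  (ends-at-0 , nonneg) , trans (sym (downsAtOdd-D-even a p)) marks

twoDyck-D-odd : ∀ {a r p} → TwoDyckFrom (+ suc (twice a)) r p → TwoDyckFrom (+ suc (twice (suc a))) (suc r) (D ∷ p)
twoDyck-D-odd {a} {p = p} ((ends-at-0 , nonneg) , marks) =
  (ends-at-0 , +≤+ z≤n ∷ nonneg) , trans (downsAtOdd-D-odd a p) (cong suc marks)

twoDyck-D-odd⁻ : ∀ {a r p} → TwoDyckFrom (+ suc (twice (suc a))) (suc r) (D ∷ p) → TwoDyckFrom (+ suc (twice a)) r p
twoDyck-D-odd⁻ {a} {p = p} ((ends-at-0 , _ ∷ nonneg) , marks) =
  (ends-at-0 , nonneg) , suc-injective (trans (sym (downsAtOdd-D-odd a p)) marks)

-- The state is the height, written 2a or 2a + 1, and the number r of down-steps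
-- still to land at an odd height.
fromEven fromOdd : ℕ → ℕ → List Step → ℕ
fromEven a       r       []      = atZero (a + r)
fromEven a       r       (U ∷ p) = fromOdd a r p
fromEven zero    r       (D ∷ p) = 0
fromEven (suc a) r       (D ∷ p) = fromEven a r p
fromOdd  a       r       []      = 0
fromOdd  a       r       (U ∷ p) = fromEven (suc a) r p
fromOdd  zero    r       (D ∷ p) = 0
fromOdd  (suc a) zero    (D ∷ p) = 0
fromOdd  (suc a) (suc r) (D ∷ p) = fromOdd a r p

fromEven-0or1 : ∀ a r p → fromEven a r p ≡ 0 ⊎ fromEven a r p ≡ 1
fromOdd-0or1  : ∀ a r p → fromOdd a r p ≡ 0 ⊎ fromOdd a r p ≡ 1
fromEven-0or1 zero    zero    []      = inj₂ refl
fromEven-0or1 zero    (suc r) []      = inj₁ refl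
fromEven-0or1 (suc a) r       []      = inj₁ refl
fromEven-0or1 a       r       (U ∷ p) = fromOdd-0or1 a r p
fromEven-0or1 zero    r       (D ∷ p) = inj₁ refl
fromEven-0or1 (suc a) r       (D ∷ p) = fromEven-0or1 a r p
fromOdd-0or1  a       r       []      = inj₁ refl
fromOdd-0or1  a       r       (U ∷ p) = fromEven-0or1 (suc a) r p
fromOdd-0or1  zero    r       (D ∷ p) = inj₁ refl
fromOdd-0or1  (suc a) zero    (D ∷ p) = inj₁ refl
fromOdd-0or1  (suc a) (suc r) (D ∷ p) = fromOdd-0or1 a r p

fromEven-sound : ∀ a r p → fromEven a r p ≡ 1 → TwoDyckFrom (+ twice a) r p
fromOdd-sound  : ∀ a r p → fromOdd a r p ≡ 1 → TwoDyckFrom (+ suc (twice a)) r p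
fromEven-sound zero    zero    []      _ = (refl , []) , refl
fromEven-sound a       r       (U ∷ p) e = twoDyck-U (fromOdd-sound a r p e)
fromEven-sound (suc a) r       (D ∷ p) e = twoDyck-D-even (fromEven-sound a r p e)
fromOdd-sound  a       r       (U ∷ p) e = twoDyck-U (fromEven-sound (suc a) r p e)
fromOdd-sound  (suc a) (suc r) (D ∷ p) e = twoDyck-D-odd (fromOdd-sound a r p e)

fromEven-complete : ∀ a r p → TwoDyckFrom (+ twice a) r p → fromEven a r p ≡ 1
fromOdd-complete  : ∀ a r p → TwoDyckFrom (+ suc (twice a)) r p → fromOdd a r p ≡ 1
fromEven-complete zero    zero    []      _               = refl
fromEven-complete zero    (suc r) []      (_ , ())
fromEven-complete (suc a) r       []      ((() , _) , _)
fromEven-complete a       r       (U ∷ p) t               = fromOdd-complete a r p (twoDyck-U⁻ t)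
fromEven-complete zero    r       (D ∷ p) ((_ , () ∷ _) , _)
fromEven-complete (suc a) r       (D ∷ p) t               = fromEven-complete a r p (twoDyck-D-even⁻ t)
fromOdd-complete  a       r       []      ((() , _) , _)
fromOdd-complete  a       r       (U ∷ p) t               = fromEven-complete (suc a) r p (twoDyck-U⁻ t)
fromOdd-complete  zero    r       (D ∷ p) ((_ , () ∷ _) , _)
fromOdd-complete  (suc a) zero    (D ∷ p) (_ , marks)     =
  contradiction (trans (sym (downsAtOdd-D-odd a p)) marks) λ ()
fromOdd-complete  (suc a) (suc r) (D ∷ p) t               = fromOdd-complete a r p (twoDyck-D-odd⁻ t)

TwoZeroDyck : ℕ → List Step → Set
TwoZeroDyck n p =
  IsKtDyck 2 0 n p × downsAtHeightMod 2 1 (+ 0) p ≡ 2 × downsAtHeightMod 2 2 (+ 0) p ≡ n ∸ 2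

twoZeroDyck? : ∀ n p → Dec (TwoZeroDyck n p)
twoZeroDyck? n p =
  isKtDyck? 2 0 n p ×-dec (downsAtHeightMod 2 1 (+ 0) p ≟ 2) ×-dec (downsAtHeightMod 2 2 (+ 0) p ≟ n ∸ 2)

twoZeroDyck-fromTwoDyck : ∀ n p → length p ≡ 3 * n → TwoDyckFrom (+ 0) 2 p → TwoZeroDyck n p
twoZeroDyck-fromTwoDyck n p len ((ends-at-0 , nonneg) , marks) =
  (len , downs≡n , ups≡2n , ends-at-0 , nonneg) , marks , evenDowns
  where
  downs≡n : countD p ≡ n
  downs≡n = countD≡ 2 p ends-at-0 len
  ups≡2n : countU p ≡ 2 * n
  ups≡2n = trans (countU≡k*countD 2 p ends-at-0) (cong (2 *_) downs≡n)
  evenDowns : downsAtHeightMod 2 2 (+ 0) p ≡ n ∸ 2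
  evenDowns = begin
    downsAtHeightMod 2 2 (+ 0) p          ≡⟨ sym (m+n∸m≡n 2 _) ⟩
    2 + downsAtHeightMod 2 2 (+ 0) p ∸ 2  ≡⟨ cong (λ m → m + downsAtHeightMod 2 2 (+ 0) p ∸ 2) (sym marks) ⟩
    downsAtHeightMod 2 1 (+ 0) p + downsAtHeightMod 2 2 (+ 0) p ∸ 2
                                          ≡⟨ cong (_∸ 2) (trans (downsAtOdd+downsAtEven≡countD (+ 0) p) downs≡n) ⟩
    n ∸ 2                                 ∎

indicator-twoZeroDyck : ∀ n p → length p ≡ 3 * n → indicator (twoZeroDyck? n) p ≡ fromEven 0 2 p
indicator-twoZeroDyck n p len = indicator-≡ (twoZeroDyck? n) (fromEven-0or1 0 2 p)
  (λ ((_ , _ , _ , ex) , marks , _) → fromEven-complete 0 2 p (ex , marks))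
  (twoZeroDyck-fromTwoDyck n p len ∘ fromEven-sound 0 2 p)

countTwoZeroDyck≡sumWords : ∀ n → countTwoZeroDyck n ≡ sumWords (3 * n) (fromEven 0 2)
countTwoZeroDyck≡sumWords n = trans (length-filter≡sum-indicator (twoZeroDyck? n) (allWords (3 * n)))
                                    (sumWords-cong (3 * n) (indicator-twoZeroDyck n))

dyckValleyIndexTotal≡sumWords : ∀ m →
  dyckValleyIndexTotal m ≡ sumWords (2 * m) (λ w → dyckFrom 0 w * valleyIndexSum w)
dyckValleyIndexTotal≡sumWords m =
  trans (sum-map-filter (isDyck? m) valleyIndexSum (allWords (2 * m)))
        (sumWords-cong (2 * m) λ w len → cong (_* valleyIndexSum w) (indicator-isDyck m w len))

evenCount oddCount : ℕ → ℕ → ℕ → ℕ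
evenCount zero    a       r       = atZero (a + r)
evenCount (suc L) zero    r       = oddCount L zero r
evenCount (suc L) (suc a) r       = oddCount L (suc a) r + evenCount L a r
oddCount  zero    a       r       = 0
oddCount  (suc L) zero    r       = evenCount L 1 r
oddCount  (suc L) (suc a) zero    = evenCount L (suc (suc a)) zero
oddCount  (suc L) (suc a) (suc r) = evenCount L (suc (suc a)) (suc r) + oddCount L a r

sumWords-fromEven : ∀ L a r → sumWords L (fromEven a r) ≡ evenCount L a r
sumWords-fromOdd  : ∀ L a r → sumWords L (fromOdd a r) ≡ oddCount L a r
sumWords-fromEven zero    a       r       = +-identityʳ _
sumWords-fromEven (suc L) zero    r       =
  trans (sumWords-suc-U L (fromEven 0 r) λ _ → refl) (sumWords-fromOdd L 0 r)
sumWords-fromEven (suc L) (suc a) r       =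
  trans (sumWords-suc L (fromEven (suc a) r)) (cong₂ _+_ (sumWords-fromOdd L (suc a) r) (sumWords-fromEven L a r))
sumWords-fromOdd  zero    a       r       = refl
sumWords-fromOdd  (suc L) zero    r       =
  trans (sumWords-suc-U L (fromOdd 0 r) λ _ → refl) (sumWords-fromEven L 1 r)
sumWords-fromOdd  (suc L) (suc a) zero    =
  trans (sumWords-suc-U L (fromOdd (suc a) 0) λ _ → refl) (sumWords-fromEven L (suc (suc a)) 0)
sumWords-fromOdd  (suc L) (suc a) (suc r) =
  trans (sumWords-suc L (fromOdd (suc a) (suc r)))
        (cong₂ _+_ (sumWords-fromEven L (suc (suc a)) (suc r)) (sumWords-fromOdd L a r))

oddCount-unmarked : ∀ L a → oddCount L a 0 ≡ evenCount (pred L) (suc a) 0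
oddCount-unmarked zero    a       = refl
oddCount-unmarked (suc L) zero    = refl
oddCount-unmarked (suc L) (suc a) = refl

evenCount≡0 : ∀ {L a} r → L < a → evenCount L a r ≡ 0
oddCount≡0  : ∀ {L a} r → L ≤ a → oddCount L a r ≡ 0
evenCount≡0 {zero}  {suc a} r _           = refl
evenCount≡0 {suc L} {suc a} r (s≤s L<a)   =
  cong₂ _+_ (oddCount≡0 r (<⇒≤ (m<n⇒m<1+n L<a))) (evenCount≡0 r L<a)
oddCount≡0  {zero}                 r _    = refl
oddCount≡0  {suc L} {suc a} zero    (s≤s L≤a) = evenCount≡0 0 (s≤s (m≤n⇒m≤1+n L≤a))
oddCount≡0  {suc L} {suc a} (suc r) (s≤s L≤a) =
  cong₂ _+_ (evenCount≡0 (suc r) (s≤s (m≤n⇒m≤1+n L≤a))) (oddCount≡0 r L≤a)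

ballots : ℕ → ℕ → ℕ
ballots zero    h       = atZero h
ballots (suc L) zero    = ballots L 1
ballots (suc L) (suc h) = ballots L (suc (suc h)) + ballots L h

valleys : ℕ → ℕ → ℕ
valleys zero    h       = 0
valleys (suc L) zero    = valleys L 1
valleys (suc L) (suc h) = valleys L (suc (suc h)) + ballots (pred L) (suc h) + valleys L h

-- There is no DUD term at height 1: the block UDDU from height 2 would go below
-- the axis.
doublyMarked : ℕ → ℕ → ℕ
doublyMarked zero    h             = 0
doublyMarked (suc L) zero          = doublyMarked L 1
doublyMarked (suc L) (suc zero)    = doublyMarked L 2 + valleys (pred L) 1 + doublyMarked L 0
doublyMarked (suc L) (suc (suc h)) =
  doublyMarked L (3 + h) + (valleys (pred L) (2 + h) + ballots (L ∸ 2) (suc h)) + doublyMarked L (suc h)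

ballots≡0 : ∀ {L h} → L < h → ballots L h ≡ 0
ballots≡0 {zero}  {suc h} _         = refl
ballots≡0 {suc L} {suc h} (s≤s L<h) = cong₂ _+_ (ballots≡0 (m<n⇒m<1+n (m<n⇒m<1+n L<h))) (ballots≡0 L<h)

valleys≡0 : ∀ {L h} → L < h → valleys L h ≡ 0
valleys≡0 {zero}          _         = refl
valleys≡0 {suc L} {suc h} (s≤s L<h) =
  cong₂ _+_ (cong₂ _+_ (valleys≡0 (m<n⇒m<1+n (m<n⇒m<1+n L<h))) (ballots≡0 (s≤s (≤-trans pred[n]≤n (<⇒≤ L<h)))))
            (valleys≡0 L<h)

doublyMarked≡0 : ∀ {L h} → L < h → doublyMarked L h ≡ 0
doublyMarked≡0 {zero}                _          = refl
doublyMarked≡0 {suc L} {suc (suc h)} (s≤s L<1+h) =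
  cong₂ _+_ (cong₂ _+_ (doublyMarked≡0 (m<n⇒m<1+n (m<n⇒m<1+n L<1+h)))
                       (cong₂ _+_ (valleys≡0 (s≤s (≤-trans pred[n]≤n (<⇒≤ L<1+h))))
                                  (ballots≡0 (s≤s (≤-trans (m∸n≤m L 2) (≤-pred L<1+h))))))
            (doublyMarked≡0 L<1+h)

-- A 2_0-Dyck path from height 2a with 2k up-steps has length 3k + a, and its
-- image has length 2k + a.
evenCount≡ballots : ∀ k a {L m} → L ≡ k * 3 + a → m ≡ k * 2 + a → evenCount L a 0 ≡ ballots m a
evenCount≡ballots zero    zero    refl refl = refl
evenCount≡ballots zero    (suc a) refl refl =
  cong₂ _+_ (trans (oddCount≡0 0 (n≤1+n a)) (sym (ballots≡0 (m<n⇒m<1+n (n<1+n a)))))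
            (evenCount≡ballots zero a refl refl)
evenCount≡ballots (suc k) zero    refl refl = evenCount≡ballots k 1 (sym (+-suc (k * 3) 0)) (sym (+-suc (k * 2) 0))
evenCount≡ballots (suc k) (suc a) refl refl =
  cong₂ _+_ (evenCount≡ballots k (suc (suc a)) (sym (+-suc (k * 3) (suc a))) (sym (+-suc (k * 2) (suc a))))
            (evenCount≡ballots (suc k) a (cong (suc ∘ suc) (+-suc (k * 3) a)) (cong suc (+-suc (k * 2) a)))

evenCount≡valleys : ∀ k a {L m} → L ≡ k * 3 + a → m ≡ k * 2 + a → evenCount L a 1 ≡ valleys m a
evenCount≡valleys zero    zero    refl refl = refl
evenCount≡valleys zero    (suc a) refl refl =
  cong₂ _+_ (trans (oddCount≡0 1 (n≤1+n a))
                   (sym (cong₂ _+_ (valleys≡0 (m<n⇒m<1+n (n<1+n a))) (ballots≡0 (s≤s (pred[n]≤n {a}))))))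
            (evenCount≡valleys zero a refl refl)
evenCount≡valleys (suc k) zero    refl refl = evenCount≡valleys k 1 (sym (+-suc (k * 3) 0)) (sym (+-suc (k * 2) 0))
evenCount≡valleys (suc k) (suc a) refl refl =
  cong₂ _+_ (cong₂ _+_ (evenCount≡valleys k (suc (suc a)) (sym (+-suc (k * 3) (suc a))) (sym (+-suc (k * 2) (suc a))))
                       (trans (oddCount-unmarked (suc (k * 3 + suc a)) a) (evenCount≡ballots k (suc a) refl refl)))
            (evenCount≡valleys (suc k) a (cong (suc ∘ suc) (+-suc (k * 3) a)) (cong suc (+-suc (k * 2) a)))

evenCount≡doublyMarked : ∀ k a {L m} → L ≡ k * 3 + a → m ≡ k * 2 + a → evenCount L a 2 ≡ doublyMarked m a
evenCount≡doublyMarked zero    zero          refl refl = refl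
evenCount≡doublyMarked zero    (suc zero)    refl refl = refl
evenCount≡doublyMarked zero    (suc (suc a)) refl refl =
  cong₂ _+_ (trans (oddCount≡0 2 (n≤1+n (suc a)))
                   (sym (cong₂ _+_ (doublyMarked≡0 (m<n⇒m<1+n (n<1+n (suc a))))
                                   (cong₂ _+_ (valleys≡0 (m<n⇒m<1+n (n<1+n a))) (ballots≡0 (s≤s (m∸n≤m a 1)))))))
            (evenCount≡doublyMarked zero (suc a) refl refl)
evenCount≡doublyMarked (suc k) zero          refl refl =
  evenCount≡doublyMarked k 1 (sym (+-suc (k * 3) 0)) (sym (+-suc (k * 2) 0))
evenCount≡doublyMarked (suc k) (suc zero)    refl refl =
  cong₂ _+_ (cong₂ _+_ (evenCount≡doublyMarked k 2 (sym (+-suc (k * 3) 1)) (sym (+-suc (k * 2) 1)))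
                       (evenCount≡valleys k 1 refl refl))
            (evenCount≡doublyMarked (suc k) 0 (cong (suc ∘ suc) (+-suc (k * 3) 0)) (cong suc (+-suc (k * 2) 0)))
evenCount≡doublyMarked (suc k) (suc (suc a)) refl refl =
  cong₂ _+_ (cong₂ _+_ (evenCount≡doublyMarked k (3 + a) (sym (+-suc (k * 3) (2 + a))) (sym (+-suc (k * 2) (2 + a))))
                       (cong₂ _+_ (evenCount≡valleys k (2 + a) refl refl)
                                  (trans (oddCount-unmarked (k * 3 + suc (suc a)) a)
                                         (evenCount≡ballots k (suc a) (cong pred (+-suc (k * 3) (suc a))) (cong pred (+-suc (k * 2) (suc a)))))))
            (evenCount≡doublyMarked (suc k) (suc a) (cong (suc ∘ suc) (+-suc (k * 3) (suc a))) (cong suc (+-suc (k * 2) (suc a))))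

valleyIndices : ℕ → ℕ → ℕ
valleyIndices zero    h       = 0
valleyIndices (suc L) zero    = valleyIndices L 1 + valleys (suc L) 0
valleyIndices (suc L) (suc h) = valleyIndices L (suc (suc h)) + valleyIndices L h + valleys (suc L) (suc h)

doublyMarked-zero : ∀ L → doublyMarked (2 + L) 0 ≡ valleyIndices L 0
doublyMarked-suc  : ∀ L h → doublyMarked (2 + L) (suc h) ≡ valleyIndices L (suc h) + valleys (suc L) h
doublyMarked-zero zero    = refl
doublyMarked-zero (suc L) = doublyMarked-suc L 0
doublyMarked-suc zero    zero          = refl
doublyMarked-suc zero    (suc zero)    = refl
doublyMarked-suc zero    (suc (suc h)) = refl
doublyMarked-suc (suc L) zero          = begin
  doublyMarked (2 + L) 2 + valleys (suc L) 1 + doublyMarked (2 + L) 0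
    ≡⟨ cong₂ (λ x y → x + valleys (suc L) 1 + y) (doublyMarked-suc L 1) (doublyMarked-zero L) ⟩
  valleyIndices L 2 + valleys (suc L) 1 + valleys (suc L) 1 + valleyIndices L 0
    ≡⟨ regroup (valleyIndices L 2) (valleys (suc L) 1) (valleyIndices L 0) ⟩
  valleyIndices L 2 + valleyIndices L 0 + valleys (suc L) 1 + valleys (suc L) 1
    ∎
  where
  regroup : ∀ r v r′ → r + v + v + r′ ≡ r + r′ + v + v
  regroup = solve-∀
doublyMarked-suc (suc L) (suc h)       = begin
  doublyMarked (2 + L) (3 + h) + (valleys (suc L) (2 + h) + ballots L (suc h)) + doublyMarked (2 + L) (suc h)
    ≡⟨ cong₂ (λ x y → x + (valleys (suc L) (2 + h) + ballots L (suc h)) + y)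
             (doublyMarked-suc L (2 + h)) (doublyMarked-suc L h) ⟩
  valleyIndices L (3 + h) + valleys (suc L) (2 + h) + (valleys (suc L) (2 + h) + ballots L (suc h))
    + (valleyIndices L (suc h) + valleys (suc L) h)
    ≡⟨ regroup (valleyIndices L (3 + h)) (valleys (suc L) (2 + h)) (ballots L (suc h))
               (valleyIndices L (suc h)) (valleys (suc L) h) ⟩
  valleyIndices L (3 + h) + valleyIndices L (suc h) + valleys (suc L) (2 + h)
    + (valleys (suc L) (2 + h) + ballots L (suc h) + valleys (suc L) h)
    ∎
  where
  regroup : ∀ r v b r′ v′ → r + v + (v + b) + (r′ + v′) ≡ r + r′ + v + (v + b + v′)
  regroup = solve-∀

sumWords-dyckFrom : ∀ L h → sumWords L (dyckFrom h) ≡ ballots L h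
sumWords-dyckFrom zero    h       = +-identityʳ (atZero h)
sumWords-dyckFrom (suc L) zero    = trans (sumWords-suc-U L (dyckFrom 0) λ _ → refl) (sumWords-dyckFrom L 1)
sumWords-dyckFrom (suc L) (suc h) =
  trans (sumWords-suc L (dyckFrom (suc h))) (cong₂ _+_ (sumWords-dyckFrom L (suc (suc h))) (sumWords-dyckFrom L h))

valleyIndexSumOverDyck : ℕ → ℕ → ℕ → ℕ
valleyIndexSumOverDyck L h i = sumWords L (λ w → dyckFrom h w * valleyIndexSumFrom i w)

-- The leading D is the down-step of a valley, of index i, exactly when w starts
-- with U; such w are counted by ballots (pred L) (suc h).
valleyIndexSumOverDyck-D : ∀ L h i →
  sumWords L (λ w → dyckFrom h w * valleyIndexSumFrom i (D ∷ w)) ≡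
  ballots (pred L) (suc h) * i + valleyIndexSumOverDyck L h (suc i)
valleyIndexSumOverDyck-D zero    h i rewrite *-zeroʳ (atZero h) = refl
valleyIndexSumOverDyck-D (suc L) h i = begin
  sumWords (suc L) (λ w → dyckFrom h w * valleyIndexSumFrom i (D ∷ w))
    ≡⟨ sumWords-suc L (λ w → dyckFrom h w * valleyIndexSumFrom i (D ∷ w)) ⟩
  sumWords L (λ w → dyckFrom (suc h) w * (i + valleyIndexSumFrom (suc i) (U ∷ w))) + Sᴰ
    ≡⟨ cong (_+ Sᴰ) (sumWords-cong L λ w _ → *-distribˡ-+ (dyckFrom (suc h) w) i _) ⟩
  sumWords L (λ w → dyckFrom (suc h) w * i + dyckFrom (suc h) w * valleyIndexSumFrom (suc i) (U ∷ w)) + Sᴰ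
    ≡⟨ cong (_+ Sᴰ) (sum-map-+ (λ w → dyckFrom (suc h) w * i) _ (allWords L)) ⟩
  sumWords L (λ w → dyckFrom (suc h) w * i) + Sᵁ + Sᴰ
    ≡⟨ cong (λ s → s + Sᵁ + Sᴰ) (trans (sum-map-*ʳ (dyckFrom (suc h)) i (allWords L))
                                        (cong (_* i) (sumWords-dyckFrom L (suc h)))) ⟩
  ballots L (suc h) * i + Sᵁ + Sᴰ
    ≡⟨ +-assoc (ballots L (suc h) * i) Sᵁ Sᴰ ⟩
  ballots L (suc h) * i + (Sᵁ + Sᴰ)
    ≡⟨ cong (λ s → ballots L (suc h) * i + s) (sym (sumWords-suc L (λ w → dyckFrom h w * valleyIndexSumFrom (suc i) w))) ⟩
  ballots L (suc h) * i + valleyIndexSumOverDyck (suc L) h (suc i)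
    ∎
  where
  Sᵁ Sᴰ : ℕ
  Sᵁ = sumWords L (λ w → dyckFrom (suc h) w * valleyIndexSumFrom (suc i) (U ∷ w))
  Sᴰ = sumWords L (λ w → dyckFrom h (D ∷ w) * valleyIndexSumFrom (suc i) (D ∷ w))

valleyIndexSumOverDyck-suc : ∀ L h j →
  valleyIndexSumOverDyck L h (suc j) ≡ j * valleys L h + valleyIndices L h
valleyIndexSumOverDyck-suc zero    h       j rewrite *-zeroʳ (atZero h) | *-zeroʳ j = refl
valleyIndexSumOverDyck-suc (suc L) zero    j = begin
  valleyIndexSumOverDyck (suc L) 0 (suc j)
    ≡⟨ sumWords-suc-U L (λ w → dyckFrom 0 w * valleyIndexSumFrom (suc j) w) (λ _ → refl) ⟩
  valleyIndexSumOverDyck L 1 (suc (suc j))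
    ≡⟨ valleyIndexSumOverDyck-suc L 1 (suc j) ⟩
  suc j * valleys L 1 + valleyIndices L 1
    ≡⟨ regroup j (valleys L 1) (valleyIndices L 1) ⟩
  j * valleys L 1 + (valleyIndices L 1 + valleys L 1)
    ∎
  where
  regroup : ∀ j v r → suc j * v + r ≡ j * v + (r + v)
  regroup = solve-∀
valleyIndexSumOverDyck-suc (suc L) (suc h) j = begin
  valleyIndexSumOverDyck (suc L) (suc h) (suc j)
    ≡⟨ sumWords-suc L (λ w → dyckFrom (suc h) w * valleyIndexSumFrom (suc j) w) ⟩
  valleyIndexSumOverDyck L (2 + h) (2 + j) + sumWords L (λ w → dyckFrom h w * valleyIndexSumFrom (suc j) (D ∷ w))
    ≡⟨ cong₂ _+_ (valleyIndexSumOverDyck-suc L (2 + h) (suc j)) (valleyIndexSumOverDyck-D L h (suc j)) ⟩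
  suc j * v₂ + r₂ + (b * suc j + valleyIndexSumOverDyck L h (2 + j))
    ≡⟨ cong (λ s → suc j * v₂ + r₂ + (b * suc j + s)) (valleyIndexSumOverDyck-suc L h (suc j)) ⟩
  suc j * v₂ + r₂ + (b * suc j + (suc j * v₀ + r₀))
    ≡⟨ regroup j v₂ r₂ b v₀ r₀ ⟩
  j * (v₂ + b + v₀) + (r₂ + r₀ + (v₂ + b + v₀))
    ∎
  where
  v₂ r₂ b v₀ r₀ : ℕ
  v₂ = valleys L (2 + h)
  r₂ = valleyIndices L (2 + h)
  b  = ballots (pred L) (suc h)
  v₀ = valleys L h
  r₀ = valleyIndices L h
  regroup : ∀ j v₂ r₂ b v₀ r₀ →
    suc j * v₂ + r₂ + (b * suc j + (suc j * v₀ + r₀)) ≡ j * (v₂ + b + v₀) + (r₂ + r₀ + (v₂ + b + v₀))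
  regroup = solve-∀

mainTheorem10 : (n : ℕ) → 2 ≤ n → countTwoZeroDyck n ≡ dyckValleyIndexTotal (n ∸ 1)
mainTheorem10 (suc m) _ = begin
  countTwoZeroDyck (suc m)                          ≡⟨ countTwoZeroDyck≡sumWords (suc m) ⟩
  sumWords (3 * suc m) (fromEven 0 2)               ≡⟨ sumWords-fromEven (3 * suc m) 0 2 ⟩
  evenCount (3 * suc m) 0 2                         ≡⟨ evenCount≡doublyMarked (suc m) 0 3n≡n*3+0 refl ⟩
  doublyMarked (2 + (m * 2 + 0)) 0                  ≡⟨ doublyMarked-zero (m * 2 + 0) ⟩
  valleyIndices (m * 2 + 0) 0                       ≡⟨ cong (λ L → valleyIndices L 0) m*2+0≡2m ⟩
  valleyIndices (2 * m) 0                           ≡⟨ sym (valleyIndexSumOverDyck-suc (2 * m) 0 0) ⟩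
  valleyIndexSumOverDyck (2 * m) 0 1                ≡⟨ sym (dyckValleyIndexTotal≡sumWords m) ⟩
  dyckValleyIndexTotal m                            ∎
  where
  3n≡n*3+0 : 3 * suc m ≡ suc m * 3 + 0
  3n≡n*3+0 = trans (*-comm 3 (suc m)) (sym (+-identityʳ _))
  m*2+0≡2m : m * 2 + 0 ≡ 2 * m
  m*2+0≡2m = trans (+-identityʳ _) (*-comm m 2)
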